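{- For any nonnegative integer $l$, there is a connected graph $G$ satisfying $p(G)-k(G)+1=l$.
   Context: All graphs are finite and simple. For an acyclic digraph $D$, the competition graph $C(D)$ has vertex set $V(D)$ with $uv$ an edge iff $u,v$ have a common out-neighbor in $D$. The competition number $k(G)$ is the smallest $k$ such that $G$ together with $k$ new isolated vertices is the competition graph of some acyclic digraph. The phylogeny graph $P(D)$ has vertex set $V(D)$, with $uv$ an edge iff $(u,v)\in A(D)$ or $(v,u)\in A(D)$ or $u,v$ have a common out-neighbor. A phylogeny digraph for $G$ is an acyclic digraph $D$ with $G$ an induced subgraph of $P(D)$ and no arcs from $V(D)\setminus V(G)$ to $V(G)$; $p(G)$ is the minimum of $|V(D)\setminus V(G)|$ over such $D$. -}

module Defs where

open import Level using (0ℓ)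
open import Data.Nat using (ℕ; _+_; _≤_; _<_)
open import Data.Fin using (Fin; _↑ˡ_; _↑ʳ_; splitAt)
open import Data.Sum using (_⊎_; inj₁; inj₂)
open import Data.Product using (Σ; ∃; ∃-syntax; _×_)
open import Data.Empty using (⊥)
open import Relation.Nullary using (¬_)
open import Relation.Binary.PropositionalEquality using (_≡_; _≢_)
open import Relation.Binary.Construct.Closure.Transitive using (TransClosure)
open import Relation.Binary.Construct.Closure.ReflexiveTransitive using (Star)
open import Function.Bundles using (_⇔_)

record Graph (n : ℕ) : Set₁ where
  field
    Adj    : Fin n → Fin n → Set
    sym    : ∀ {u v} → Adj u v → Adj v u
    irrefl : ∀ {u} → ¬ Adj u u
open Graph public

Connected : ∀ {n} → Graph n → Set
Connected {n} G = (0 < n) × (∀ u v → Star (Adj G) u v)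

Digraph : ℕ → Set₁
Digraph m = Fin m → Fin m → Set

Acyclic : ∀ {m} → Digraph m → Set
Acyclic D = ∀ u → ¬ TransClosure D u u

CommonPrey : ∀ {m} → Digraph m → Fin m → Fin m → Set
CommonPrey {m} D u v = ∃[ w ] (D u w × D v w)

CompEdge : ∀ {m} → Digraph m → Fin m → Fin m → Set
CompEdge D u v = (u ≢ v) × CommonPrey D u v

PhyloEdge : ∀ {m} → Digraph m → Fin m → Fin m → Set
PhyloEdge D u v = (u ≢ v) × (D u v ⊎ D v u ⊎ CommonPrey D u v)

-- Edge relation of G together with k new isolated vertices
-- (vertices of G are  i ↑ˡ k , new vertices are  n ↑ʳ j ).
AdjPlusIsolated : ∀ {n} (G : Graph n) (k : ℕ) → Fin (n + k) → Fin (n + k) → Set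
AdjPlusIsolated {n} G k u v with splitAt n u | splitAt n v
... | inj₁ a | inj₁ b = Adj G a b
... | _      | _      = ⊥

CompetitionRealizable : ∀ {n} → Graph n → ℕ → Set₁
CompetitionRealizable {n} G k =
  Σ (Digraph (n + k)) λ D → Acyclic D ×
    (∀ u v → AdjPlusIsolated G k u v ⇔ CompEdge D u v)

IsCompetitionNumber : ∀ {n} → Graph n → ℕ → Set₁
IsCompetitionNumber G k =
  CompetitionRealizable G k × (∀ k′ → CompetitionRealizable G k′ → k ≤ k′)

PhylogenyDigraph : ∀ {n} → Graph n → (p : ℕ) → Digraph (n + p) → Set
PhylogenyDigraph {n} G p D =
  Acyclic D ×
  (∀ (u v : Fin n) → Adj G u v ⇔ PhyloEdge D (u ↑ˡ p) (v ↑ˡ p)) ×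
  (∀ (x : Fin p) (v : Fin n) → ¬ D (n ↑ʳ x) (v ↑ˡ p))

PhylogenyRealizable : ∀ {n} → Graph n → ℕ → Set₁
PhylogenyRealizable {n} G p = Σ (Digraph (n + p)) (PhylogenyDigraph G p)

IsPhylogenyNumber : ∀ {n} → Graph n → ℕ → Set₁
IsPhylogenyNumber G p =
  PhylogenyRealizable G p × (∀ p′ → PhylogenyRealizable G p′ → p ≤ p′)

module Submission where

-- For l = 0 take K₂ (k = 1, p = 0).  For l = r ≥ 1 take G_r: r octahedra K₂,₂,₂
-- sharing one vertex, the hub, plus a clique of 2r vertices adjacent to the hub;
-- then k(G_r) = 1 and p(G_r) = r.
--
-- Lower bounds rest on
-- the fact that a nonempty finite acyclic digraph has a sink (acyclic⇒sink): it
-- gives k ≥ 1 for graphs without isolated vertices (competition-positive), and a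
-- local lemma (PhylogenyLocal.sharedExtraPrey) showing that each octahedron with
-- the hub has its own extra vertex in any phylogeny digraph, whence p ≥ r.

open import Defs
open import Data.Nat using (ℕ; zero; suc; _+_; _*_; _∸_; _≤_; _<_; z≤n; s≤s; _≤?_; _<?_)
open import Data.Nat.Properties using (<-irrefl; <-trans; ≤-<-trans; n<1+n; m∸n+n≡m)
open import Data.Fin using (Fin; zero; suc; toℕ; _↑ˡ_; _↑ʳ_; splitAt; join; combine; remQuot)
open import Data.Fin.Patterns using (0F; 1F; 2F; 3F; 4F; 5F)
open import Data.Fin.Properties
  using (pigeonhole; splitAt-↑ˡ; splitAt-↑ʳ; splitAt⁻¹-↑ˡ; splitAt⁻¹-↑ʳ;
         remQuot-combine; combine-remQuot; ↑ˡ-injective; injective⇒≤; toℕ<n; _≟_)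
open import Data.Product using (Σ; _×_; _,_; proj₁; proj₂; ∃; ∃-syntax; uncurry) renaming (map to ×-map)
open import Data.Sum using (_⊎_; inj₁; inj₂) renaming (map to ⊎-map)
open import Data.Empty using (⊥; ⊥-elim)
open import Data.Unit using (⊤; tt)
open import Relation.Nullary using (¬_; yes; no)
open import Relation.Nullary.Decidable using (decidable-stable; True; toWitness; ¬?; _×-dec_)
open import Relation.Binary.PropositionalEquality
  using (_≡_; _≢_; refl; trans; cong; cong₂; subst; subst₂) renaming (sym to ≡-sym)
open import Relation.Binary.Construct.Closure.Transitive using (TransClosure; [_]; _∷_; _∷ʳ_)
open import Relation.Binary.Construct.Closure.ReflexiveTransitive using (Star; ε; _◅_; _◅◅_; reverse; gmap)
open import Function using (id; _∘_)
open import Function.Bundles using (_⇔_; mk⇔; Equivalence)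
open Equivalence using (to; from)
open import Function.Construct.Composition using (_⇔-∘_)

ranked⇒acyclic : ∀ {m} {D : Digraph m} (rank : Fin m → ℕ) →
                 (∀ {u v} → D u v → rank u < rank v) → Acyclic D
ranked⇒acyclic {D = D} rank increasing u cycle = <-irrefl refl (rises cycle)
  where
    rises : ∀ {u v} → TransClosure D u v → rank u < rank v
    rises [ d ]    = increasing d
    rises (d ∷ ds) = <-trans (increasing d) (rises ds)

lessThan : ∀ {m n} {m<n : True (m <? n)} → m < n
lessThan {m<n = m<n} = toWitness m<n

restrict-acyclic : ∀ {s m} {D : Digraph m} (f : Fin s → Fin m) →
                   Acyclic D → Acyclic (λ x y → D (f x) (f y))
restrict-acyclic {D = D} f acyclic x cycle = acyclic (f x) (push cycle)
  where
    push : ∀ {x y} → TransClosure (λ x y → D (f x) (f y)) x y → TransClosure D (f x) (f y)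
    push [ d ]    = [ d ]
    push (d ∷ ds) = d ∷ push ds

-- Following out-neighbours from a vertex u₀ of a digraph in which every vertex
-- has one; by pigeonhole the first m+1 steps revisit a vertex and close a cycle.
module Iteration {m} (D : Digraph m) (next : ∀ u → ∃ (D u)) (u₀ : Fin m) where
  iterate : ℕ → Fin m
  iterate zero    = u₀
  iterate (suc t) = proj₁ (next (iterate t))

  walk : ∀ t d → TransClosure D (iterate t) (iterate (d + suc t))
  walk t zero    = [ proj₂ (next (iterate t)) ]
  walk t (suc d) = walk t d ∷ʳ proj₂ (next (iterate (d + suc t)))

  cycle : ∃[ u ] TransClosure D u u
  cycle with i , j , i<j , same ← pigeonhole (n<1+n m) (iterate ∘ toℕ) =
    iterate (toℕ i) ,
    subst (TransClosure D (iterate (toℕ i)))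
          (trans (cong iterate (m∸n+n≡m i<j)) (≡-sym same))
          (walk (toℕ i) (toℕ j ∸ suc (toℕ i)))

acyclic⇒sink : ∀ {m} (D : Digraph m) → Acyclic D → Fin m → ¬ (∀ u → ∃ (D u))
acyclic⇒sink D acyclic u₀ next = uncurry acyclic (Iteration.cycle D next u₀)

¬¬-choice : ∀ {r} {P : Fin r → Set} → (∀ i → ¬ ¬ P i) → ¬ ¬ (∀ i → P i)
¬¬-choice {zero}      h k = k (λ ())
¬¬-choice {suc r} {P} h k =
  h zero λ p₀ → ¬¬-choice {r} {P ∘ suc} (h ∘ suc) λ ps → k λ { zero → p₀ ; (suc i) → ps i }

-- An enumeration identifies a vertex type A with Fin m, so that graphs and
-- digraphs can be described on a structured type and transported to Fin m.
record Enumeration (A : Set) (m : ℕ) : Set where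
  field
    index         : A → Fin m
    element       : Fin m → A
    element-index : ∀ a → element (index a) ≡ a
    index-element : ∀ u → index (element u) ≡ u

  element-injective : ∀ {u v} → element u ≡ element v → u ≡ v
  element-injective {u} {v} e =
    trans (≡-sym (index-element u)) (trans (cong index e) (index-element v))

  index-injective : ∀ {a b} → index a ≡ index b → a ≡ b
  index-injective {a} {b} e =
    trans (≡-sym (element-index a)) (trans (cong element e) (element-index b))

open Enumeration

finEnum : ∀ m → Enumeration (Fin m) m
finEnum m = record { index = id ; element = id ; element-index = λ _ → refl ; index-element = λ _ → refl }

_⊕_ : ∀ {A B m n} → Enumeration A m → Enumeration B n → Enumeration (A ⊎ B) (m + n)
_⊕_ {m = m} {n} E F = record
  { index         = join m n ∘ ⊎-map (index E) (index F)
  ; element       = ⊎-map (element E) (element F) ∘ splitAt m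
  ; element-index = element-index⊎
  ; index-element = index-element⊎
  }
  where
    element-index⊎ : ∀ x → ⊎-map (element E) (element F) (splitAt m (join m n (⊎-map (index E) (index F) x))) ≡ x
    element-index⊎ (inj₁ a) rewrite splitAt-↑ˡ m (index E a) n = cong inj₁ (element-index E a)
    element-index⊎ (inj₂ b) rewrite splitAt-↑ʳ m n (index F b) = cong inj₂ (element-index F b)

    index-element⊎ : ∀ u → join m n (⊎-map (index E) (index F) (⊎-map (element E) (element F) (splitAt m u))) ≡ u
    index-element⊎ u with splitAt m u in eq
    ... | inj₁ a = trans (cong (_↑ˡ n) (index-element E a)) (splitAt⁻¹-↑ˡ eq)
    ... | inj₂ b = trans (cong (m ↑ʳ_) (index-element F b)) (splitAt⁻¹-↑ʳ eq)

_⊗_ : ∀ {A B m n} → Enumeration A m → Enumeration B n → Enumeration (A × B) (m * n)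
_⊗_ {m = m} {n} E F = record
  { index         = uncurry combine ∘ ×-map (index E) (index F)
  ; element       = ×-map (element E) (element F) ∘ remQuot n
  ; element-index = λ (a , b) →
      trans (cong (×-map (element E) (element F)) (remQuot-combine (index E a) (index F b)))
            (cong₂ _,_ (element-index E a) (element-index F b))
  ; index-element = λ u →
      trans (cong₂ combine (index-element E _) (index-element F _)) (combine-remQuot {m} n u)
  }

reindex : ∀ {A B m} (f : A → B) (g : B → A) → (∀ a → g (f a) ≡ a) → (∀ b → f (g b) ≡ b) →
          Enumeration B m → Enumeration A m
reindex f g g∘f f∘g E = record
  { index         = index E ∘ f
  ; element       = g ∘ element E
  ; element-index = λ a → trans (cong g (element-index E (f a))) (g∘f a)
  ; index-element = λ u → trans (cong (index E) (f∘g (element E u))) (index-element E u)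
  }

record GraphOn (A : Set) : Set₁ where
  field
    _~_      : A → A → Set
    ~-sym    : ∀ {a b} → a ~ b → b ~ a
    ~-irrefl : ∀ {a} → ¬ a ~ a

open GraphOn

enumerate : ∀ {A n} → Enumeration A n → GraphOn A → Graph n
enumerate E H = record
  { Adj    = λ u v → _~_ H (element E u) (element E v)
  ; sym    = ~-sym H
  ; irrefl = ~-irrefl H
  }

Lift : ∀ {A B : Set} → GraphOn A → A ⊎ B → A ⊎ B → Set
Lift H (inj₁ a) (inj₁ b) = _~_ H a b
Lift H _        _        = ⊥

Lift-irrefl : ∀ {A B : Set} (H : GraphOn A) {x y : A ⊎ B} → Lift H x y → x ≢ y
Lift-irrefl H {inj₁ a} edge refl = ~-irrefl H edge

module _ {A n} (E : Enumeration A n) (H : GraphOn A) where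

  adjacent-index : ∀ {a b} → Adj (enumerate E H) (index E a) (index E b) ⇔ _~_ H a b
  adjacent-index {a} {b} = mk⇔ (subst₂ (_~_ H) (element-index E a) (element-index E b))
                               (subst₂ (_~_ H) (≡-sym (element-index E a)) (≡-sym (element-index E b)))

  enumerate-connected : (c : A) → (∀ a → Star (_~_ H) a c) → Connected (enumerate E H)
  enumerate-connected c toCentre =
    ≤-<-trans z≤n (toℕ<n (index E c)) , λ u v → walkToCentre u ◅◅ reverse (sym (enumerate E H)) (walkToCentre v)
    where
      step : ∀ {a b} → _~_ H a b → Adj (enumerate E H) (index E a) (index E b)
      step = from adjacent-index

      walkToCentre : ∀ u → Star (Adj (enumerate E H)) u (index E c)
      walkToCentre u = subst (λ w → Star (Adj (enumerate E H)) w (index E c)) (index-element E u)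
                             (gmap (index E) step (toCentre (element E u)))

  enumerate-neighbour : (∀ a → ∃ (_~_ H a)) → ∀ u → ∃ (Adj (enumerate E H) u)
  enumerate-neighbour neighbour u =
    let (b , edge) = neighbour (element E u)
    in index E b , subst (_~_ H (element E u)) (≡-sym (element-index E b)) edge

SharedPrey : ∀ {W : Set} → (W → W → Set) → W → W → Set
SharedPrey {W} P x y = ∃[ z ] (P x z × P y z)

PhyloRel : ∀ {W : Set} → (W → W → Set) → W → W → Set
PhyloRel P x y = x ≢ y × (P x y ⊎ P y x ⊎ SharedPrey P x y)

Pull : ∀ {W m} → Enumeration W m → (W → W → Set) → Digraph m
Pull E P u v = P (element E u) (element E v)

module Transport {W m} (E : Enumeration W m) (P : W → W → Set) where

  acyclic-by-rank : (rank : W → ℕ) → (∀ {x y} → P x y → rank x < rank y) → Acyclic (Pull E P)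
  acyclic-by-rank rank increasing = ranked⇒acyclic (rank ∘ element E) increasing

  distinct : ∀ {u v} → u ≢ v ⇔ element E u ≢ element E v
  distinct = mk⇔ (λ u≢v → u≢v ∘ element-injective E) (λ ne → ne ∘ cong (element E))

  sharedPrey : ∀ {u v} → CommonPrey (Pull E P) u v ⇔ SharedPrey P (element E u) (element E v)
  sharedPrey {u} {v} = mk⇔
    (λ (w , p , q) → element E w , p , q)
    (λ (z , p , q) → index E z , subst (P (element E u)) (≡-sym (element-index E z)) p
                               , subst (P (element E v)) (≡-sym (element-index E z)) q)

  phyloEdge : ∀ {u v} → PhyloEdge (Pull E P) u v ⇔ PhyloRel P (element E u) (element E v)
  phyloEdge {u} {v} = mk⇔
    (λ (u≢v , link) → to distinct u≢v , ⊎-map id (⊎-map id (to (sharedPrey {u} {v}))) link)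
    (λ (x≢y , link) → from distinct x≢y , ⊎-map id (⊎-map id (from (sharedPrey {u} {v}))) link)

module Realise {A n} (E : Enumeration A n) (H : GraphOn A) where
  private
    G : Graph n
    G = enumerate E H

    _~H_ : A → A → Set
    _~H_ = _~_ H

  element-old : ∀ {k} u → element (E ⊕ finEnum k) (u ↑ˡ k) ≡ inj₁ (element E u)
  element-old {k} u = cong (⊎-map (element E) id) (splitAt-↑ˡ n u k)

  element-new : ∀ {k} j → element (E ⊕ finEnum k) (n ↑ʳ j) ≡ inj₂ j
  element-new {k} j = cong (⊎-map (element E) id) (splitAt-↑ʳ n k j)

  plusIsolated : ∀ {k} u v →
    AdjPlusIsolated G k u v ⇔ Lift H (element (E ⊕ finEnum k) u) (element (E ⊕ finEnum k) v)
  plusIsolated u v with splitAt n u | splitAt n v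
  ... | inj₁ a | inj₁ b = mk⇔ id id
  ... | inj₁ a | inj₂ j = mk⇔ id id
  ... | inj₂ i | _      = mk⇔ id id

  competition-by-cliques : ∀ {k} (P : A ⊎ Fin k → A ⊎ Fin k → Set) (rank : A ⊎ Fin k → ℕ) →
    (∀ {x y} → P x y → rank x < rank y) →
    (∀ {x y z} → P x z → P y z → x ≢ y → Lift H x y) →
    (∀ {x y} → Lift H x y → SharedPrey P x y) →
    CompetitionRealizable G k
  competition-by-cliques {k} P rank increasing clique cover =
    Pull W P , acyclic-by-rank rank increasing , λ u v → mk⇔
      (λ adj → let edge = to (plusIsolated u v) adj in
               from distinct (Lift-irrefl H edge) , from sharedPrey (cover edge))
      (λ (u≢v , prey) → let (_ , p , q) = to sharedPrey prey in
                        from (plusIsolated u v) (clique p q (to distinct u≢v)))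
    where
      W : Enumeration (A ⊎ Fin k) (n + k)
      W = E ⊕ finEnum k
      open Transport W P

  phylogeny-by-cliques : ∀ {p} (P : A ⊎ Fin p → A ⊎ Fin p → Set) (rank : A ⊎ Fin p → ℕ) →
    (∀ {x y} → P x y → rank x < rank y) →
    (∀ {a b} → P (inj₁ a) (inj₁ b) → a ~H b) →
    (∀ {a b z} → P (inj₁ a) z → P (inj₁ b) z → a ≢ b → a ~H b) →
    (∀ {a b} → a ~H b → P (inj₁ a) (inj₁ b) ⊎ P (inj₁ b) (inj₁ a) ⊎ SharedPrey P (inj₁ a) (inj₁ b)) →
    (∀ {j a} → ¬ P (inj₂ j) (inj₁ a)) →
    PhylogenyRealizable G p
  phylogeny-by-cliques {p} P rank increasing arc clique cover sourceless =
    Pull W P , acyclic-by-rank rank increasing , induced , noArcFromNew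
    where
      W : Enumeration (A ⊎ Fin p) (n + p)
      W = E ⊕ finEnum p
      open Transport W P

      oldEdge : ∀ {a b} → a ~H b ⇔ PhyloRel P (inj₁ a) (inj₁ b)
      oldEdge = mk⇔
        (λ edge → (λ { refl → ~-irrefl H edge }) , cover edge)
        (λ { (_ , inj₁ d) → arc d
           ; (_ , inj₂ (inj₁ d)) → ~-sym H (arc d)
           ; (a≢b , inj₂ (inj₂ (_ , d , d′))) → clique d d′ (a≢b ∘ cong inj₁) })

      induced : ∀ u v → Adj G u v ⇔ PhyloEdge (Pull W P) (u ↑ˡ p) (v ↑ˡ p)
      induced u v = mk⇔
        (λ edge → from phyloEdge (subst₂ (PhyloRel P) (≡-sym (element-old u)) (≡-sym (element-old v))
                                          (to oldEdge edge)))
        (λ link → from oldEdge (subst₂ (PhyloRel P) (element-old u) (element-old v) (to phyloEdge link)))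

      noArcFromNew : ∀ j v → ¬ Pull W P (n ↑ʳ j) (v ↑ˡ p)
      noArcFromNew j v d = sourceless (subst₂ P (element-new j) (element-old v) d)

plusIsolated-old : ∀ {n} (G : Graph n) k {u v a b} →
  splitAt n u ≡ inj₁ a → splitAt n v ≡ inj₁ b → Adj G a b → AdjPlusIsolated G k u v
plusIsolated-old G k u≡a v≡b edge rewrite u≡a | v≡b = edge

-- A nonempty graph without isolated vertices has competition number at least 1:
-- with no extra vertex every vertex needs a prey, contradicting acyclic⇒sink.
competition-positive : ∀ {n} (G : Graph n) → Fin n → (∀ u → ∃ (Adj G u)) →
                       ∀ k → CompetitionRealizable G k → 1 ≤ k
competition-positive G u₀ neighbour (suc k) _ = s≤s z≤n
competition-positive {n} G u₀ neighbour zero (D , acyclic , competition) =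
  ⊥-elim (acyclic⇒sink D acyclic (u₀ ↑ˡ 0) prey)
  where
    prey : ∀ u → ∃ (D u)
    prey u with splitAt n u in u≡a
    ... | inj₁ a =
      let (b , edge)        = neighbour a
          (_ , w , d , _)   = to (competition u (b ↑ˡ 0))
                                 (plusIsolated-old G 0 u≡a (splitAt-↑ˡ n b 0) edge)
      in w , d

oldOrExtra : ∀ {n p} (w : Fin (n + p)) → (∃[ c ] c ↑ˡ p ≡ w) ⊎ (∃[ j ] n ↑ʳ j ≡ w)
oldOrExtra {n} w with splitAt n w in eq
... | inj₁ c = inj₁ (c , splitAt⁻¹-↑ˡ eq)
... | inj₂ j = inj₂ (j , splitAt⁻¹-↑ʳ eq)

module PhylogenyLocal {n p} (G : Graph n) (D : Digraph (n + p)) (acyclic : Acyclic D)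
    (induced : ∀ u v → Adj G u v ⇔ PhyloEdge D (u ↑ˡ p) (v ↑ˡ p)) where

  arc⇒edge : ∀ {a b} → D (a ↑ˡ p) (b ↑ˡ p) → Adj G a b
  arc⇒edge {a} d =
    from (induced a _) ((λ a≡b → acyclic (a ↑ˡ p) [ subst (D (a ↑ˡ p)) (≡-sym a≡b) d ]) , inj₁ d)

  sharedPrey⇒edge : ∀ {a b w} → a ≢ b → D (a ↑ˡ p) w → D (b ↑ˡ p) w → Adj G a b
  sharedPrey⇒edge a≢b d d′ = from (induced _ _) ((a≢b ∘ ↑ˡ-injective p _ _) , inj₂ (inj₂ (_ , d , d′)))

  Closed : ∀ {s} → (Fin s → Fin n) → Set
  Closed X = ∀ {x y v} → x ≢ y → Adj G (X x) v → Adj G (X y) v → ∃[ z ] X z ≡ v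

  NoSimplicial : ∀ {s} → (Fin s → Fin n) → Set
  NoSimplicial X = ∀ x → ∃[ y ] ∃[ y′ ]
    (Adj G (X x) (X y) × Adj G (X x) (X y′) × X y ≢ X y′ × ¬ Adj G (X y) (X y′))

  SharedExtraPrey : ∀ {s} → (Fin s → Fin n) → Fin p → Set
  SharedExtraPrey X w = ∃[ x ] ∃[ y ] (x ≢ y × D (X x ↑ˡ p) (n ↑ʳ w) × D (X y ↑ˡ p) (n ↑ʳ w))

  -- Some extra vertex is a shared prey of X.  Otherwise, at a sink x of D
  -- restricted to X every edge xy of X must be an arc y → x (a common prey
  -- would be old, hence in X by closedness, or extra); then two non-adjacent
  -- neighbours of x would share the prey x.
  sharedExtraPrey : ∀ {s} (X : Fin (suc s) → Fin n) → Closed X → NoSimplicial X →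
                    ¬ ¬ ∃ (SharedExtraPrey X)
  sharedExtraPrey {s} X closed noSimplicial none =
    ¬¬-choice notSink (acyclic⇒sink _ (restrict-acyclic old acyclic) zero)
    where
      old : Fin (suc s) → Fin (n + p)
      old x = X x ↑ˡ p

      distinct : ∀ {x y} → Adj G (X x) (X y) → x ≢ y
      distinct edge refl = irrefl G edge

      intoSink : ∀ {x y} → ¬ ∃ (λ z → D (old x) (old z)) → Adj G (X x) (X y) → D (old y) (old x)
      intoSink {x} {y} sink edge with to (induced (X x) (X y)) edge
      ... | _ , inj₁ d        = ⊥-elim (sink (y , d))
      ... | _ , inj₂ (inj₁ d) = d
      ... | _ , inj₂ (inj₂ (w , d , d′)) with oldOrExtra {n} {p} w
      ...   | inj₂ (j , refl) = ⊥-elim (none (j , x , y , distinct edge , d , d′))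
      ...   | inj₁ (c , refl) =
        let (z , Xz≡c) = closed (distinct edge) (arc⇒edge d) (arc⇒edge d′)
        in ⊥-elim (sink (z , subst (λ c → D (old x) (c ↑ˡ p)) (≡-sym Xz≡c) d))

      notSink : ∀ x → ¬ ¬ ∃ (λ z → D (old x) (old z))
      notSink x sink =
        let (y , y′ , edge , edge′ , Xy≢Xy′ , nonadjacent) = noSimplicial x
        in nonadjacent (sharedPrey⇒edge Xy≢Xy′ (intoSink sink edge) (intoSink sink edge′))

-- The octahedron K₂,₂,₂ on positions Fin 6 with antipodal pairs {0,3}, {1,4},
-- {2,5}: two positions are adjacent iff they are distinct and not antipodal.
antipode : Fin 6 → Fin 6
antipode 0F = 3F
antipode 1F = 4F
antipode 2F = 5F
antipode 3F = 0F
antipode 4F = 1F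
antipode 5F = 2F

antipode-involutive : ∀ x → antipode (antipode x) ≡ x
antipode-involutive 0F = refl
antipode-involutive 1F = refl
antipode-involutive 2F = refl
antipode-involutive 3F = refl
antipode-involutive 4F = refl
antipode-involutive 5F = refl

OctAdj : Fin 6 → Fin 6 → Set
OctAdj x y = x ≢ y × antipode x ≢ y

octAdj-sym : ∀ {x y} → OctAdj x y → OctAdj y x
octAdj-sym {x} {y} (x≢y , x̄≢y) =
  x≢y ∘ ≡-sym , λ ȳ≡x → x̄≢y (trans (cong antipode (≡-sym ȳ≡x)) (antipode-involutive y))

octEdge : ∀ {x y} {adjacent : True (¬? (x ≟ y) ×-dec ¬? (antipode x ≟ y))} → OctAdj x y
octEdge {adjacent = adjacent} = toWitness adjacent

wedge : ∀ x → ∃[ y ] (OctAdj x y × OctAdj x (antipode y))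
wedge 0F = 1F , octEdge , octEdge
wedge 1F = 2F , octEdge , octEdge
wedge 2F = 3F , octEdge , octEdge
wedge 3F = 4F , octEdge , octEdge
wedge 4F = 5F , octEdge , octEdge
wedge 5F = 0F , octEdge , octEdge

antipode-fixpointFree : ∀ x → x ≢ antipode x
antipode-fixpointFree 0F ()
antipode-fixpointFree 1F ()
antipode-fixpointFree 2F ()
antipode-fixpointFree 3F ()
antipode-fixpointFree 4F ()
antipode-fixpointFree 5F ()

-- The graph G_r: a hub, r octahedra sharing the hub as their position 0, and a
-- clique of 2r vertices cl i s, all adjacent to the hub.  The non-hub
-- vertices of octahedron i are oc i t, at position suc t; the octahedron's
-- antipodal classes are {hub, A₂}, {B₁, B₂}, {C₁, C₂}.
data V (r : ℕ) : Set where
  hub : V r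
  cl  : Fin r → Fin 2 → V r
  oc  : Fin r → Fin 5 → V r

pattern B₁ = 0F
pattern C₁ = 1F
pattern A₂ = 2F
pattern B₂ = 3F
pattern C₂ = 4F

loc : ∀ {r} → Fin r → Fin 6 → V r
loc i zero    = hub
loc i (suc t) = oc i t

Adjacent : ∀ {r} → V r → V r → Set
Adjacent hub      hub       = ⊥
Adjacent hub      (cl _ _)  = ⊤
Adjacent hub      (oc _ t)  = OctAdj 0F (suc t)
Adjacent (cl _ _) hub       = ⊤
Adjacent (cl i s) (cl j s′) = (i , s) ≢ (j , s′)
Adjacent (cl _ _) (oc _ _)  = ⊥
Adjacent (oc _ t) hub       = OctAdj (suc t) 0F
Adjacent (oc _ _) (cl _ _)  = ⊥
Adjacent (oc i t) (oc j t′) = i ≡ j × OctAdj (suc t) (suc t′)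

Adjacent-sym : ∀ {r} {x y : V r} → Adjacent x y → Adjacent y x
Adjacent-sym {x = hub}    {cl _ _}  _          = tt
Adjacent-sym {x = hub}    {oc _ _}  e          = octAdj-sym e
Adjacent-sym {x = cl _ _} {hub}     _          = tt
Adjacent-sym {x = cl _ _} {cl _ _}  ne         = ne ∘ ≡-sym
Adjacent-sym {x = oc _ _} {hub}     e          = octAdj-sym e
Adjacent-sym {x = oc _ _} {oc _ _}  (i≡j , e)  = ≡-sym i≡j , octAdj-sym e

Adjacent-irrefl : ∀ {r} {x : V r} → ¬ Adjacent x x
Adjacent-irrefl {x = cl _ _} ne              = ne refl
Adjacent-irrefl {x = oc _ _} (_ , x≢x , _)   = x≢x refl

octahedral : ∀ r → GraphOn (V r)
octahedral r = record { _~_ = Adjacent ; ~-sym = Adjacent-sym ; ~-irrefl = Adjacent-irrefl }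

loc-adjacent : ∀ {r} (i : Fin r) x y → Adjacent (loc i x) (loc i y) ⇔ OctAdj x y
loc-adjacent i zero    zero     = mk⇔ ⊥-elim (λ (x≢x , _) → x≢x refl)
loc-adjacent i zero    (suc t)  = mk⇔ id id
loc-adjacent i (suc t) zero     = mk⇔ id id
loc-adjacent i (suc t) (suc t′) = mk⇔ proj₂ (refl ,_)

loc-injective : ∀ {r} (i : Fin r) {x y} → loc i x ≡ loc i y → x ≡ y
loc-injective i {zero}  {zero}   _    = refl
loc-injective i {suc t} {suc .t} refl = refl

vEnum : ∀ r → Enumeration (V r) (1 + r * (2 + 5))
vEnum r = reindex encode decode (λ { hub → refl ; (cl _ _) → refl ; (oc _ _) → refl })
                                (λ { (inj₁ zero) → refl ; (inj₂ (_ , inj₁ _)) → refl ; (inj₂ (_ , inj₂ _)) → refl })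
                                (finEnum 1 ⊕ (finEnum r ⊗ (finEnum 2 ⊕ finEnum 5)))
  where
    encode : V r → Fin 1 ⊎ Fin r × (Fin 2 ⊎ Fin 5)
    encode hub      = inj₁ zero
    encode (cl i s) = inj₂ (i , inj₁ s)
    encode (oc i t) = inj₂ (i , inj₂ t)

    decode : Fin 1 ⊎ Fin r × (Fin 2 ⊎ Fin 5) → V r
    decode (inj₁ _)            = hub
    decode (inj₂ (i , inj₁ s)) = cl i s
    decode (inj₂ (i , inj₂ t)) = oc i t

Gr : ∀ r → Graph (1 + r * (2 + 5))
Gr r = enumerate (vEnum r) (octahedral r)

toHub : ∀ {r} (x : V r) → Star Adjacent x hub
toHub hub       = ε
toHub (cl _ _)  = tt ◅ ε
toHub (oc i B₁) = octEdge ◅ ε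
toHub (oc i C₁) = octEdge ◅ ε
toHub (oc i A₂) = _◅_ {j = oc i B₁} (refl , octEdge) (octEdge ◅ ε)
toHub (oc i B₂) = octEdge ◅ ε
toHub (oc i C₂) = octEdge ◅ ε

Gr-connected : ∀ r → Connected (Gr r)
Gr-connected r = enumerate-connected (vEnum r) (octahedral r) hub toHub

neighbour : ∀ {r} (x : V (suc r)) → ∃ (Adjacent x)
neighbour hub       = oc zero B₁ , octEdge
neighbour (cl _ _)  = hub , tt
neighbour (oc i B₁) = hub , octEdge
neighbour (oc i C₁) = hub , octEdge
neighbour (oc i A₂) = oc i B₁ , refl , octEdge
neighbour (oc i B₂) = hub , octEdge
neighbour (oc i C₂) = hub , octEdge

-- In octahedron i the
-- faces {hub, B₁, C₁}, {A₂, B₁, C₂}, {hub, B₂, C₂}, {A₂, B₂, C₁} cover every edge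
-- once and prey on A₂, B₂, cl i 0 and cl i 1; the hub and the clique prey on z.
data CompArc {r} : V r ⊎ Fin 1 → V r ⊎ Fin 1 → Set where
  hub→A₂  : ∀ {i} → CompArc (inj₁ hub)       (inj₁ (oc i A₂))
  B₁→A₂   : ∀ {i} → CompArc (inj₁ (oc i B₁)) (inj₁ (oc i A₂))
  C₁→A₂   : ∀ {i} → CompArc (inj₁ (oc i C₁)) (inj₁ (oc i A₂))
  A₂→B₂   : ∀ {i} → CompArc (inj₁ (oc i A₂)) (inj₁ (oc i B₂))
  B₁→B₂   : ∀ {i} → CompArc (inj₁ (oc i B₁)) (inj₁ (oc i B₂))
  C₂→B₂   : ∀ {i} → CompArc (inj₁ (oc i C₂)) (inj₁ (oc i B₂))
  hub→cl₀ : ∀ {i} → CompArc (inj₁ hub)       (inj₁ (cl i 0F))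
  B₂→cl₀  : ∀ {i} → CompArc (inj₁ (oc i B₂)) (inj₁ (cl i 0F))
  C₂→cl₀  : ∀ {i} → CompArc (inj₁ (oc i C₂)) (inj₁ (cl i 0F))
  A₂→cl₁  : ∀ {i} → CompArc (inj₁ (oc i A₂)) (inj₁ (cl i 1F))
  B₂→cl₁  : ∀ {i} → CompArc (inj₁ (oc i B₂)) (inj₁ (cl i 1F))
  C₁→cl₁  : ∀ {i} → CompArc (inj₁ (oc i C₁)) (inj₁ (cl i 1F))
  hub→z   : ∀ {z} → CompArc (inj₁ hub)       (inj₂ z)
  cl→z    : ∀ {i s z} → CompArc (inj₁ (cl i s)) (inj₂ z)

compRank : ∀ {r} → V r ⊎ Fin 1 → ℕ
compRank (inj₁ hub)       = 0
compRank (inj₁ (oc _ B₁)) = 1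
compRank (inj₁ (oc _ C₁)) = 2
compRank (inj₁ (oc _ A₂)) = 3
compRank (inj₁ (oc _ C₂)) = 4
compRank (inj₁ (oc _ B₂)) = 5
compRank (inj₁ (cl _ _))  = 6
compRank (inj₂ _)         = 7

compRank-increasing : ∀ {r} {x y : V r ⊎ Fin 1} → CompArc x y → compRank x < compRank y
compRank-increasing hub→A₂  = lessThan
compRank-increasing B₁→A₂   = lessThan
compRank-increasing C₁→A₂   = lessThan
compRank-increasing A₂→B₂   = lessThan
compRank-increasing B₁→B₂   = lessThan
compRank-increasing C₂→B₂   = lessThan
compRank-increasing hub→cl₀ = lessThan
compRank-increasing B₂→cl₀  = lessThan
compRank-increasing C₂→cl₀  = lessThan
compRank-increasing A₂→cl₁  = lessThan
compRank-increasing B₂→cl₁  = lessThan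
compRank-increasing C₁→cl₁  = lessThan
compRank-increasing hub→z   = lessThan
compRank-increasing cl→z    = lessThan

compClique : ∀ {r} {x y z : V r ⊎ Fin 1} → CompArc x z → CompArc y z → x ≢ y → Lift (octahedral r) x y
compClique hub→A₂  hub→A₂  x≢y = ⊥-elim (x≢y refl)
compClique hub→A₂  B₁→A₂   _   = octEdge
compClique hub→A₂  C₁→A₂   _   = octEdge
compClique B₁→A₂   hub→A₂  _   = octEdge
compClique B₁→A₂   B₁→A₂   x≢y = ⊥-elim (x≢y refl)
compClique B₁→A₂   C₁→A₂   _   = refl , octEdge
compClique C₁→A₂   hub→A₂  _   = octEdge
compClique C₁→A₂   B₁→A₂   _   = refl , octEdge
compClique C₁→A₂   C₁→A₂   x≢y = ⊥-elim (x≢y refl)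
compClique A₂→B₂   A₂→B₂   x≢y = ⊥-elim (x≢y refl)
compClique A₂→B₂   B₁→B₂   _   = refl , octEdge
compClique A₂→B₂   C₂→B₂   _   = refl , octEdge
compClique B₁→B₂   A₂→B₂   _   = refl , octEdge
compClique B₁→B₂   B₁→B₂   x≢y = ⊥-elim (x≢y refl)
compClique B₁→B₂   C₂→B₂   _   = refl , octEdge
compClique C₂→B₂   A₂→B₂   _   = refl , octEdge
compClique C₂→B₂   B₁→B₂   _   = refl , octEdge
compClique C₂→B₂   C₂→B₂   x≢y = ⊥-elim (x≢y refl)
compClique hub→cl₀ hub→cl₀ x≢y = ⊥-elim (x≢y refl)
compClique hub→cl₀ B₂→cl₀  _   = octEdge
compClique hub→cl₀ C₂→cl₀  _   = octEdge
compClique B₂→cl₀  hub→cl₀ _   = octEdge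
compClique B₂→cl₀  B₂→cl₀  x≢y = ⊥-elim (x≢y refl)
compClique B₂→cl₀  C₂→cl₀  _   = refl , octEdge
compClique C₂→cl₀  hub→cl₀ _   = octEdge
compClique C₂→cl₀  B₂→cl₀  _   = refl , octEdge
compClique C₂→cl₀  C₂→cl₀  x≢y = ⊥-elim (x≢y refl)
compClique A₂→cl₁  A₂→cl₁  x≢y = ⊥-elim (x≢y refl)
compClique A₂→cl₁  B₂→cl₁  _   = refl , octEdge
compClique A₂→cl₁  C₁→cl₁  _   = refl , octEdge
compClique B₂→cl₁  A₂→cl₁  _   = refl , octEdge
compClique B₂→cl₁  B₂→cl₁  x≢y = ⊥-elim (x≢y refl)
compClique B₂→cl₁  C₁→cl₁  _   = refl , octEdge
compClique C₁→cl₁  A₂→cl₁  _   = refl , octEdge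
compClique C₁→cl₁  B₂→cl₁  _   = refl , octEdge
compClique C₁→cl₁  C₁→cl₁  x≢y = ⊥-elim (x≢y refl)
compClique hub→z   hub→z   x≢y = ⊥-elim (x≢y refl)
compClique hub→z   cl→z    _   = tt
compClique cl→z    hub→z   _   = tt
compClique cl→z    cl→z    x≢y = λ { refl → x≢y refl }

compCoverOct : ∀ {r} (i : Fin r) {x y} → OctAdj x y →
               SharedPrey CompArc (inj₁ (loc i x)) (inj₁ (loc i y))
compCoverOct i {0F} {0F} (x≢y , _) = ⊥-elim (x≢y refl)
compCoverOct i {0F} {1F} _ = _ , hub→A₂ , B₁→A₂
compCoverOct i {0F} {2F} _ = _ , hub→A₂ , C₁→A₂
compCoverOct i {0F} {3F} (_ , x̄≢y) = ⊥-elim (x̄≢y refl)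
compCoverOct i {0F} {4F} _ = _ , hub→cl₀ , B₂→cl₀
compCoverOct i {0F} {5F} _ = _ , hub→cl₀ , C₂→cl₀
compCoverOct i {1F} {0F} _ = _ , B₁→A₂ , hub→A₂
compCoverOct i {1F} {1F} (x≢y , _) = ⊥-elim (x≢y refl)
compCoverOct i {1F} {2F} _ = _ , B₁→A₂ , C₁→A₂
compCoverOct i {1F} {3F} _ = _ , B₁→B₂ , A₂→B₂
compCoverOct i {1F} {4F} (_ , x̄≢y) = ⊥-elim (x̄≢y refl)
compCoverOct i {1F} {5F} _ = _ , B₁→B₂ , C₂→B₂
compCoverOct i {2F} {0F} _ = _ , C₁→A₂ , hub→A₂
compCoverOct i {2F} {1F} _ = _ , C₁→A₂ , B₁→A₂
compCoverOct i {2F} {2F} (x≢y , _) = ⊥-elim (x≢y refl)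
compCoverOct i {2F} {3F} _ = _ , C₁→cl₁ , A₂→cl₁
compCoverOct i {2F} {4F} _ = _ , C₁→cl₁ , B₂→cl₁
compCoverOct i {2F} {5F} (_ , x̄≢y) = ⊥-elim (x̄≢y refl)
compCoverOct i {3F} {0F} (_ , x̄≢y) = ⊥-elim (x̄≢y refl)
compCoverOct i {3F} {1F} _ = _ , A₂→B₂ , B₁→B₂
compCoverOct i {3F} {2F} _ = _ , A₂→cl₁ , C₁→cl₁
compCoverOct i {3F} {3F} (x≢y , _) = ⊥-elim (x≢y refl)
compCoverOct i {3F} {4F} _ = _ , A₂→cl₁ , B₂→cl₁
compCoverOct i {3F} {5F} _ = _ , A₂→B₂ , C₂→B₂
compCoverOct i {4F} {0F} _ = _ , B₂→cl₀ , hub→cl₀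
compCoverOct i {4F} {1F} (_ , x̄≢y) = ⊥-elim (x̄≢y refl)
compCoverOct i {4F} {2F} _ = _ , B₂→cl₁ , C₁→cl₁
compCoverOct i {4F} {3F} _ = _ , B₂→cl₁ , A₂→cl₁
compCoverOct i {4F} {4F} (x≢y , _) = ⊥-elim (x≢y refl)
compCoverOct i {4F} {5F} _ = _ , B₂→cl₀ , C₂→cl₀
compCoverOct i {5F} {0F} _ = _ , C₂→cl₀ , hub→cl₀
compCoverOct i {5F} {1F} _ = _ , C₂→B₂ , B₁→B₂
compCoverOct i {5F} {2F} (_ , x̄≢y) = ⊥-elim (x̄≢y refl)
compCoverOct i {5F} {3F} _ = _ , C₂→B₂ , A₂→B₂
compCoverOct i {5F} {4F} _ = _ , C₂→cl₀ , B₂→cl₀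
compCoverOct i {5F} {5F} (x≢y , _) = ⊥-elim (x≢y refl)

compCover : ∀ {r} {x y : V r ⊎ Fin 1} → Lift (octahedral r) x y → SharedPrey CompArc x y
compCover {x = inj₁ hub}      {inj₁ (cl _ _)}  _         = inj₂ 0F , hub→z , cl→z
compCover {x = inj₁ hub}      {inj₁ (oc i t)}  e         = compCoverOct i {0F} {suc t} e
compCover {x = inj₁ (cl _ _)} {inj₁ hub}       _         = inj₂ 0F , cl→z , hub→z
compCover {x = inj₁ (cl _ _)} {inj₁ (cl _ _)}  _         = inj₂ 0F , cl→z , cl→z
compCover {x = inj₁ (oc i t)} {inj₁ hub}       e         = compCoverOct i {suc t} {0F} e
compCover {x = inj₁ (oc i t)} {inj₁ (oc .i u)} (refl , e) = compCoverOct i {suc t} {suc u} e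

competition-upper : ∀ r → CompetitionRealizable (Gr r) 1
competition-upper r =
  Realise.competition-by-cliques (vEnum r) (octahedral r) CompArc compRank compRank-increasing compClique compCover

-- A phylogeny digraph for G_r with one extra vertex i per octahedron i: the
-- clique points to the hub; nine edges of octahedron i are arcs, the edges
-- B₁C₂ and A₂C₂ are realised by the common prey i of B₁, A₂, C₂, and the edge
-- hub B₂ by the common prey C₂.
data PhyloArc {r} : V r ⊎ Fin r → V r ⊎ Fin r → Set where
  cl→hub : ∀ {i s} → PhyloArc (inj₁ (cl i s)) (inj₁ hub)
  hub→B₁ : ∀ {i} → PhyloArc (inj₁ hub)       (inj₁ (oc i B₁))
  hub→C₁ : ∀ {i} → PhyloArc (inj₁ hub)       (inj₁ (oc i C₁))
  hub→C₂ : ∀ {i} → PhyloArc (inj₁ hub)       (inj₁ (oc i C₂))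
  B₁→C₁  : ∀ {i} → PhyloArc (inj₁ (oc i B₁)) (inj₁ (oc i C₁))
  B₁→A₂  : ∀ {i} → PhyloArc (inj₁ (oc i B₁)) (inj₁ (oc i A₂))
  C₁→A₂  : ∀ {i} → PhyloArc (inj₁ (oc i C₁)) (inj₁ (oc i A₂))
  C₁→B₂  : ∀ {i} → PhyloArc (inj₁ (oc i C₁)) (inj₁ (oc i B₂))
  A₂→B₂  : ∀ {i} → PhyloArc (inj₁ (oc i A₂)) (inj₁ (oc i B₂))
  B₂→C₂  : ∀ {i} → PhyloArc (inj₁ (oc i B₂)) (inj₁ (oc i C₂))
  B₁→new : ∀ {i} → PhyloArc (inj₁ (oc i B₁)) (inj₂ i)
  A₂→new : ∀ {i} → PhyloArc (inj₁ (oc i A₂)) (inj₂ i)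
  C₂→new : ∀ {i} → PhyloArc (inj₁ (oc i C₂)) (inj₂ i)

phyloRank : ∀ {r} → V r ⊎ Fin r → ℕ
phyloRank (inj₁ (cl _ _))  = 0
phyloRank (inj₁ hub)       = 1
phyloRank (inj₁ (oc _ B₁)) = 2
phyloRank (inj₁ (oc _ C₁)) = 3
phyloRank (inj₁ (oc _ A₂)) = 4
phyloRank (inj₁ (oc _ B₂)) = 5
phyloRank (inj₁ (oc _ C₂)) = 6
phyloRank (inj₂ _)         = 7

phyloRank-increasing : ∀ {r} {x y : V r ⊎ Fin r} → PhyloArc x y → phyloRank x < phyloRank y
phyloRank-increasing cl→hub = lessThan
phyloRank-increasing hub→B₁ = lessThan
phyloRank-increasing hub→C₁ = lessThan
phyloRank-increasing hub→C₂ = lessThan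
phyloRank-increasing B₁→C₁  = lessThan
phyloRank-increasing B₁→A₂  = lessThan
phyloRank-increasing C₁→A₂  = lessThan
phyloRank-increasing C₁→B₂  = lessThan
phyloRank-increasing A₂→B₂  = lessThan
phyloRank-increasing B₂→C₂  = lessThan
phyloRank-increasing B₁→new = lessThan
phyloRank-increasing A₂→new = lessThan
phyloRank-increasing C₂→new = lessThan

phyloArc-edge : ∀ {r} {a b : V r} → PhyloArc (inj₁ a) (inj₁ b) → Adjacent a b
phyloArc-edge cl→hub = tt
phyloArc-edge hub→B₁ = octEdge
phyloArc-edge hub→C₁ = octEdge
phyloArc-edge hub→C₂ = octEdge
phyloArc-edge B₁→C₁  = refl , octEdge
phyloArc-edge B₁→A₂  = refl , octEdge
phyloArc-edge C₁→A₂  = refl , octEdge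
phyloArc-edge C₁→B₂  = refl , octEdge
phyloArc-edge A₂→B₂  = refl , octEdge
phyloArc-edge B₂→C₂  = refl , octEdge

phyloClique : ∀ {r} {a b : V r} {z} → PhyloArc (inj₁ a) z → PhyloArc (inj₁ b) z → a ≢ b → Adjacent a b
phyloClique cl→hub cl→hub a≢b = λ { refl → a≢b refl }
phyloClique hub→B₁ hub→B₁ a≢b = ⊥-elim (a≢b refl)
phyloClique hub→C₁ hub→C₁ a≢b = ⊥-elim (a≢b refl)
phyloClique hub→C₁ B₁→C₁  _   = octEdge
phyloClique B₁→C₁  hub→C₁ _   = octEdge
phyloClique B₁→C₁  B₁→C₁  a≢b = ⊥-elim (a≢b refl)
phyloClique hub→C₂ hub→C₂ a≢b = ⊥-elim (a≢b refl)
phyloClique hub→C₂ B₂→C₂  _   = octEdge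
phyloClique B₂→C₂  hub→C₂ _   = octEdge
phyloClique B₂→C₂  B₂→C₂  a≢b = ⊥-elim (a≢b refl)
phyloClique B₁→A₂  B₁→A₂  a≢b = ⊥-elim (a≢b refl)
phyloClique B₁→A₂  C₁→A₂  _   = refl , octEdge
phyloClique C₁→A₂  B₁→A₂  _   = refl , octEdge
phyloClique C₁→A₂  C₁→A₂  a≢b = ⊥-elim (a≢b refl)
phyloClique C₁→B₂  C₁→B₂  a≢b = ⊥-elim (a≢b refl)
phyloClique C₁→B₂  A₂→B₂  _   = refl , octEdge
phyloClique A₂→B₂  C₁→B₂  _   = refl , octEdge
phyloClique A₂→B₂  A₂→B₂  a≢b = ⊥-elim (a≢b refl)
phyloClique B₁→new B₁→new a≢b = ⊥-elim (a≢b refl)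
phyloClique B₁→new A₂→new _   = refl , octEdge
phyloClique B₁→new C₂→new _   = refl , octEdge
phyloClique A₂→new B₁→new _   = refl , octEdge
phyloClique A₂→new A₂→new a≢b = ⊥-elim (a≢b refl)
phyloClique A₂→new C₂→new _   = refl , octEdge
phyloClique C₂→new B₁→new _   = refl , octEdge
phyloClique C₂→new A₂→new _   = refl , octEdge
phyloClique C₂→new C₂→new a≢b = ⊥-elim (a≢b refl)

PhyloLink : ∀ {r} → V r → V r → Set
PhyloLink {r} a b = PhyloArc (inj₁ a) (inj₁ b) ⊎ PhyloArc (inj₁ b) (inj₁ a) ⊎ SharedPrey (PhyloArc {r}) (inj₁ a) (inj₁ b)

phyloCoverOct : ∀ {r} (i : Fin r) {x y} → OctAdj x y → PhyloLink (loc i x) (loc i y)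
phyloCoverOct i {0F} {0F} (x≢y , _) = ⊥-elim (x≢y refl)
phyloCoverOct i {0F} {1F} _ = inj₁ hub→B₁
phyloCoverOct i {0F} {2F} _ = inj₁ hub→C₁
phyloCoverOct i {0F} {3F} (_ , x̄≢y) = ⊥-elim (x̄≢y refl)
phyloCoverOct i {0F} {4F} _ = inj₂ (inj₂ (_ , hub→C₂ , B₂→C₂))
phyloCoverOct i {0F} {5F} _ = inj₁ hub→C₂
phyloCoverOct i {1F} {0F} _ = inj₂ (inj₁ hub→B₁)
phyloCoverOct i {1F} {1F} (x≢y , _) = ⊥-elim (x≢y refl)
phyloCoverOct i {1F} {2F} _ = inj₁ B₁→C₁
phyloCoverOct i {1F} {3F} _ = inj₁ B₁→A₂
phyloCoverOct i {1F} {4F} (_ , x̄≢y) = ⊥-elim (x̄≢y refl)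
phyloCoverOct i {1F} {5F} _ = inj₂ (inj₂ (_ , B₁→new , C₂→new))
phyloCoverOct i {2F} {0F} _ = inj₂ (inj₁ hub→C₁)
phyloCoverOct i {2F} {1F} _ = inj₂ (inj₁ B₁→C₁)
phyloCoverOct i {2F} {2F} (x≢y , _) = ⊥-elim (x≢y refl)
phyloCoverOct i {2F} {3F} _ = inj₁ C₁→A₂
phyloCoverOct i {2F} {4F} _ = inj₁ C₁→B₂
phyloCoverOct i {2F} {5F} (_ , x̄≢y) = ⊥-elim (x̄≢y refl)
phyloCoverOct i {3F} {0F} (_ , x̄≢y) = ⊥-elim (x̄≢y refl)
phyloCoverOct i {3F} {1F} _ = inj₂ (inj₁ B₁→A₂)
phyloCoverOct i {3F} {2F} _ = inj₂ (inj₁ C₁→A₂)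
phyloCoverOct i {3F} {3F} (x≢y , _) = ⊥-elim (x≢y refl)
phyloCoverOct i {3F} {4F} _ = inj₁ A₂→B₂
phyloCoverOct i {3F} {5F} _ = inj₂ (inj₂ (_ , A₂→new , C₂→new))
phyloCoverOct i {4F} {0F} _ = inj₂ (inj₂ (_ , B₂→C₂ , hub→C₂))
phyloCoverOct i {4F} {1F} (_ , x̄≢y) = ⊥-elim (x̄≢y refl)
phyloCoverOct i {4F} {2F} _ = inj₂ (inj₁ C₁→B₂)
phyloCoverOct i {4F} {3F} _ = inj₂ (inj₁ A₂→B₂)
phyloCoverOct i {4F} {4F} (x≢y , _) = ⊥-elim (x≢y refl)
phyloCoverOct i {4F} {5F} _ = inj₁ B₂→C₂
phyloCoverOct i {5F} {0F} _ = inj₂ (inj₁ hub→C₂)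
phyloCoverOct i {5F} {1F} _ = inj₂ (inj₂ (_ , C₂→new , B₁→new))
phyloCoverOct i {5F} {2F} (_ , x̄≢y) = ⊥-elim (x̄≢y refl)
phyloCoverOct i {5F} {3F} _ = inj₂ (inj₂ (_ , C₂→new , A₂→new))
phyloCoverOct i {5F} {4F} _ = inj₂ (inj₁ B₂→C₂)
phyloCoverOct i {5F} {5F} (x≢y , _) = ⊥-elim (x≢y refl)

phyloCover : ∀ {r} {a b : V r} → Adjacent a b → PhyloLink a b
phyloCover {a = hub}    {cl _ _}  _          = inj₂ (inj₁ cl→hub)
phyloCover {a = hub}    {oc i t}  e          = phyloCoverOct i {0F} {suc t} e
phyloCover {a = cl _ _} {hub}     _          = inj₁ cl→hub
phyloCover {a = cl _ _} {cl _ _}  _          = inj₂ (inj₂ (_ , cl→hub , cl→hub))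
phyloCover {a = oc i t} {hub}     e          = phyloCoverOct i {suc t} {0F} e
phyloCover {a = oc i t} {oc .i u} (refl , e) = phyloCoverOct i {suc t} {suc u} e

phylogeny-upper : ∀ r → PhylogenyRealizable (Gr r) r
phylogeny-upper r =
  Realise.phylogeny-by-cliques (vEnum r) (octahedral r) PhyloArc phyloRank phyloRank-increasing
    phyloArc-edge phyloClique phyloCover (λ ())

competition-lower : ∀ r k → CompetitionRealizable (Gr (suc r)) k → 1 ≤ k
competition-lower r = competition-positive (Gr (suc r)) (index (vEnum (suc r)) hub)
                        (enumerate-neighbour (vEnum (suc r)) (octahedral (suc r)) neighbour)

octahedron-closed : ∀ {r} (i : Fin r) {x y} (v : V r) → x ≢ y →
                    Adjacent (loc i x) v → Adjacent (loc i y) v → ∃[ z ] loc i z ≡ v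
octahedron-closed i hub           _   _        _        = 0F , refl
octahedron-closed i {0F} {0F}     v   x≢y      _        _        = ⊥-elim (x≢y refl)
octahedron-closed i {0F} {suc _}  (cl _ _) _   _        ()
octahedron-closed i {suc _}       (cl _ _) _   ()       _
octahedron-closed i {suc _}       (oc j t) _   (refl , _) _        = suc t , refl
octahedron-closed i {0F} {suc _}  (oc j t) _   _        (refl , _) = suc t , refl

-- The lower bound p(G_r) ≥ r, for a phylogeny digraph D of G_r: hub ∪ octahedron i
-- is closed and has no simplicial vertex, so (classically) some extra vertex w_i
-- is a prey of one of its non-hub vertices; the w_i are distinct because
-- non-hub vertices of different octahedra are not adjacent.
module PhylogenyLowerBound {r p} (D : Digraph (1 + r * (2 + 5) + p)) (acyclic : Acyclic D)
    (induced : ∀ u v → Adj (Gr r) u v ⇔ PhyloEdge D (u ↑ˡ p) (v ↑ˡ p)) where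
  private
    n : ℕ
    n = 1 + r * (2 + 5)

    E : Enumeration (V r) n
    E = vEnum r
  open PhylogenyLocal (Gr r) D acyclic induced

  X : Fin r → Fin 6 → Fin n
  X i = index E ∘ loc i

  adjacent-X : ∀ i x y → Adj (Gr r) (X i x) (X i y) ⇔ OctAdj x y
  adjacent-X i x y = loc-adjacent i x y ⇔-∘ adjacent-index E (octahedral r)

  closed : ∀ i → Closed (X i)
  closed i {x} {y} {v} x≢y edge edge′ =
    let (z , locz≡v) = octahedron-closed i (element E v) x≢y
                         (subst (λ a → Adjacent a (element E v)) (element-index E (loc i x)) edge)
                         (subst (λ a → Adjacent a (element E v)) (element-index E (loc i y)) edge′)
    in z , trans (cong (index E) locz≡v) (index-element E v)

  noSimplicial : ∀ i → NoSimplicial (X i)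
  noSimplicial i x =
    let (y , edge , edge′) = wedge x
    in y , antipode y , from (adjacent-X i x y) edge , from (adjacent-X i x (antipode y)) edge′
     , antipode-fixpointFree y ∘ loc-injective i ∘ index-injective E
     , λ adjacent → proj₂ (to (adjacent-X i y (antipode y)) adjacent) refl

  nonHubPredator : ∀ {i w} → SharedExtraPrey (X i) w → ∃[ t ] D (index E (oc i t) ↑ˡ p) (n ↑ʳ w)
  nonHubPredator (0F    , 0F    , x≢y , _) = ⊥-elim (x≢y refl)
  nonHubPredator (suc t , _     , _   , d , _) = t , d
  nonHubPredator (0F    , suc t , _   , _ , d) = t , d

  distinctPrey : (choice : ∀ i → ∃ (SharedExtraPrey (X i))) →
                 ∀ {i j} → proj₁ (choice i) ≡ proj₁ (choice j) → i ≡ j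
  distinctPrey choice {i} {j} same
    with t , d ← nonHubPredator (proj₂ (choice i)) | t′ , d′ ← nonHubPredator (proj₂ (choice j))
    with index E (oc i t) ≟ index E (oc j t′)
  ... | yes same-vertex = sameOctahedron (index-injective E same-vertex)
    where
      sameOctahedron : oc i t ≡ oc j t′ → i ≡ j
      sameOctahedron refl = refl
  ... | no different =
    proj₁ (to (adjacent-index E (octahedral r) {oc i t} {oc j t′})
              (sharedPrey⇒edge different d (subst (λ w → D _ (n ↑ʳ w)) (≡-sym same) d′)))

  lowerBound : r ≤ p
  lowerBound = decidable-stable (r ≤? p) λ r≰p →
    ¬¬-choice (λ i → sharedExtraPrey (X i) (closed i) (noSimplicial i))
              (λ choice → r≰p (injective⇒≤ (distinctPrey choice)))

phylogeny-lower : ∀ r p → PhylogenyRealizable (Gr r) p → r ≤ p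
phylogeny-lower r p (D , acyclic , induced , _) = PhylogenyLowerBound.lowerBound D acyclic induced

complete₂ : GraphOn (Fin 2)
complete₂ = record { _~_ = _≢_ ; ~-sym = λ a≢b → a≢b ∘ ≡-sym ; ~-irrefl = λ a≢a → a≢a refl }

K₂ : Graph 2
K₂ = enumerate (finEnum 2) complete₂

K₂-connected : Connected K₂
K₂-connected = enumerate-connected (finEnum 2) complete₂ 0F λ { 0F → ε ; 1F → (λ ()) ◅ ε }

data K₂CompArc : Fin 2 ⊎ Fin 1 → Fin 2 ⊎ Fin 1 → Set where
  toExtra : ∀ {a z} → K₂CompArc (inj₁ a) (inj₂ z)

K₂-competition : CompetitionRealizable K₂ 1
K₂-competition = Realise.competition-by-cliques (finEnum 2) complete₂ K₂CompArc rank
  (λ { toExtra → s≤s z≤n })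
  (λ { toExtra toExtra x≢y → x≢y ∘ cong inj₁ })
  (λ { {inj₁ _} {inj₁ _} _ → inj₂ 0F , toExtra , toExtra })
  where
    rank : Fin 2 ⊎ Fin 1 → ℕ
    rank (inj₁ _) = 0
    rank (inj₂ _) = 1

data K₂PhyloArc : Fin 2 ⊎ Fin 0 → Fin 2 ⊎ Fin 0 → Set where
  0→1 : K₂PhyloArc (inj₁ 0F) (inj₁ 1F)

K₂-phylogeny : PhylogenyRealizable K₂ 0
K₂-phylogeny = Realise.phylogeny-by-cliques (finEnum 2) complete₂ K₂PhyloArc rank
  (λ { 0→1 → s≤s z≤n })
  (λ { 0→1 () })
  (λ { 0→1 0→1 a≢b → ⊥-elim (a≢b refl) })
  cover
  (λ ())
  where
    rank : Fin 2 ⊎ Fin 0 → ℕ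
    rank (inj₁ a) = toℕ a
    rank (inj₂ ())

    cover : ∀ {a b} → a ≢ b → K₂PhyloArc (inj₁ a) (inj₁ b) ⊎ K₂PhyloArc (inj₁ b) (inj₁ a) ⊎
                               SharedPrey K₂PhyloArc (inj₁ a) (inj₁ b)
    cover {0F} {0F} a≢b = ⊥-elim (a≢b refl)
    cover {0F} {1F} _   = inj₁ 0→1
    cover {1F} {0F} _   = inj₂ (inj₁ 0→1)
    cover {1F} {1F} a≢b = ⊥-elim (a≢b refl)

theorem8 : (l : ℕ) → Σ ℕ λ n → Σ (Graph n) λ G → Connected G × Σ ℕ λ k → Σ ℕ λ p →
             IsCompetitionNumber G k × IsPhylogenyNumber G p × (p + 1 ≡ l + k)
theorem8 zero =
  2 , K₂ , K₂-connected , 1 , 0 ,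
  (K₂-competition , competition-positive K₂ 0F (λ { 0F → 1F , (λ ()) ; 1F → 0F , (λ ()) })) ,
  (K₂-phylogeny , λ _ _ → z≤n) ,
  refl
theorem8 (suc r) =
  _ , Gr (suc r) , Gr-connected (suc r) , 1 , suc r ,
  (competition-upper (suc r) , competition-lower r) ,
  (phylogeny-upper (suc r) , phylogeny-lower (suc r)) ,
  refl
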